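{- Let $\Gamma$ be a simplicial complex whose $1$-skeleton (graph) contains, as an induced subgraph on some four vertices, one of the following three graphs: two disjoint edges ($2K_2$), the path with four vertices ($P_4$), or the cycle with four vertices ($C_4$). Then for every simplicial complex $\Delta$ (on a vertex set disjoint from that of $\Gamma$), \[ \mathrm{ctd}(\Delta*\Gamma)\;\ge\;\mathrm{ctd}(\Delta)+1 . \]
   Context: For a finite family $\mathcal{P}=(P_1,\dots,P_n)$ of convex bodies (equivalently, convex polytopes) in $\mathbb{R}^d$, each containing the origin, and a point $\mu\in\mathbb{R}^d$, the Minkowski complex $\Delta(\mathcal{P};\mu)$ is the simplicial complex of all $\sigma\subseteq[n]$ with $\mu\notin P_\sigma:=\sum_{i\in\sigma}P_i$ (Minkowski sum; $P_\emptyset=\{0\}$). Every simplicial complex on vertex set $[n]$ arises in this way in some dimension. The convex threshold dimension $\mathrm{ctd}(\Delta)$ of a simplicial complex $\Delta\subseteq 2^{[n]}$ is the smallest $d\ge 0$ such that $\Delta=\Delta(\mathcal{P};\mu)$ for some such family $\mathcal{P}$ of $n$ convex bodies in $\mathbb{R}^d$ containing the origin and some $\mu\in\mathbb{R}^d$. The join of complexes $\Delta,\Gamma$ on disjoint vertex sets is $\Delta*\Gamma=\{\sigma\uplus\tau:\sigma\in\Delta,\tau\in\Gamma\}$. The three graphs $2K_2$, $P_4$, $C_4$ are the forbidden induced subgraphs characterizing threshold graphs (Chvátal–Hammer).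
   Formalization: The convex threshold dimension is taken over convex polytopes with rational vertices in ℚ^d and a rational point μ, instead of convex bodies in ℝ^d. -}

module Defs where

open import Data.Nat using (ℕ; zero; suc; _+_; _≤_)
open import Data.Fin using (Fin; zero; suc)
open import Data.Bool using (Bool; true; false; if_then_else_)
open import Data.Vec using (Vec; []; _∷_; zipWith; replicate; map; take; drop; lookup)
open import Data.Fin.Subset using (Subset; _∈_; _⊆_; ⊥; ⁅_⁆; _∪_)
open import Data.Rational using (ℚ; 0ℚ; 1ℚ) renaming (_+_ to _+ℚ_; _*_ to _*ℚ_; _≤_ to _≤ℚ_)
open import Data.Product using (Σ; _×_; ∃)
open import Data.Sum using (_⊎_)
open import Relation.Binary.PropositionalEquality using (_≡_; _≢_)
open import Relation.Nullary using (¬_)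
open import Function.Bundles using (_⇔_)

Family : ℕ → Set₁
Family n = Subset n → Set

record SimplicialComplex (n : ℕ) : Set₁ where
  field
    Face        : Family n
    empty-face  : Face ⊥
    down-closed : ∀ {σ τ} → τ ⊆ σ → Face σ → Face τ
open SimplicialComplex public

-- Join of a family on [n] with a family on [m], living on
-- [n] ⊎ [m] ≅ Fin (n + m): the first n vertices come from the first
-- family, the last m from the second.  σ ∈ Δ * Γ iff σ = σ₁ ⊎ σ₂ with
-- σ₁ ∈ Δ and σ₂ ∈ Γ.
_*ᶠ_ : ∀ {n m} → Family n → Family m → Family (n + m)
_*ᶠ_ {n} Δ Γ σ = Δ (take n σ) × Γ (drop n σ)

Point : ℕ → Set
Point d = Vec ℚ d

0ᵥ : ∀ {d} → Point d
0ᵥ = replicate _ 0ℚ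

_+ᵥ_ : ∀ {d} → Point d → Point d → Point d
_+ᵥ_ = zipWith _+ℚ_

_·ᵥ_ : ∀ {d} → ℚ → Point d → Point d
c ·ᵥ v = map (c *ℚ_) v

sumℚ : ∀ {k} → (Fin k → ℚ) → ℚ
sumℚ {zero}  f = 0ℚ
sumℚ {suc k} f = f zero +ℚ sumℚ (λ j → f (suc j))

sumᵥ : ∀ {k d} → (Fin k → Point d) → Point d
sumᵥ {zero}  f = 0ᵥ
sumᵥ {suc k} f = f zero +ᵥ sumᵥ (λ j → f (suc j))

-- Convex polytopes in ℚ^d, given as convex hulls of finitely many points

record Polytope (d : ℕ) : Set where
  field
    #vert : ℕ
    vert  : Fin #vert → Point d
open Polytope public

_∈ᴾ_ : ∀ {d} → Point d → Polytope d → Set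
p ∈ᴾ P = Σ (Fin (#vert P) → ℚ) λ λs →
           (∀ j → 0ℚ ≤ℚ λs j) × (sumℚ λs ≡ 1ℚ) ×
           (sumᵥ (λ j → λs j ·ᵥ vert P j) ≡ p)

InMinkowskiSum : ∀ {n d} → (Fin n → Polytope d) → Subset n → Point d → Set
InMinkowskiSum {n} {d} P σ μ =
  Σ (Fin n → Point d) λ p →
    (∀ i → i ∈ σ → p i ∈ᴾ P i) ×
    (sumᵥ (λ i → if lookup σ i then p i else 0ᵥ) ≡ μ)

RealizableIn : ∀ {n} → Family n → ℕ → Set
RealizableIn {n} Δ d =
  Σ (Fin n → Polytope d) λ P → Σ (Point d) λ μ →
    (∀ i → 0ᵥ ∈ᴾ P i) ×
    (∀ σ → Δ σ ⇔ (¬ InMinkowskiSum P σ μ))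

IsCtd : ∀ {n} → Family n → ℕ → Set
IsCtd Δ c = RealizableIn Δ c × (∀ d → RealizableIn Δ d → c ≤ d)

Edge : ∀ {n} → Family n → Fin n → Fin n → Set
Edge Δ a b = Δ (⁅ a ⁆ ∪ ⁅ b ⁆)

Distinct4 : ∀ {n} → Fin n → Fin n → Fin n → Fin n → Set
Distinct4 a b c d = a ≢ b × a ≢ c × a ≢ d × b ≢ c × b ≢ d × c ≢ d

Induced2K2 : ∀ {n} → Family n → Fin n → Fin n → Fin n → Fin n → Set
Induced2K2 Δ a b c d =
  Edge Δ a b × Edge Δ c d ×
  ¬ Edge Δ a c × ¬ Edge Δ a d × ¬ Edge Δ b c × ¬ Edge Δ b d

InducedP4 : ∀ {n} → Family n → Fin n → Fin n → Fin n → Fin n → Set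
InducedP4 Δ a b c d =
  Edge Δ a b × Edge Δ b c × Edge Δ c d ×
  ¬ Edge Δ a c × ¬ Edge Δ a d × ¬ Edge Δ b d

InducedC4 : ∀ {n} → Family n → Fin n → Fin n → Fin n → Fin n → Set
InducedC4 Δ a b c d =
  Edge Δ a b × Edge Δ b c × Edge Δ c d × Edge Δ d a ×
  ¬ Edge Δ a c × ¬ Edge Δ b d

HasInduced2K2orP4orC4 : ∀ {n} → Family n → Set
HasInduced2K2orP4orC4 {n} Δ =
  Σ (Fin n) λ a → Σ (Fin n) λ b → Σ (Fin n) λ c → Σ (Fin n) λ d →
    Distinct4 a b c d ×
    (Induced2K2 Δ a b c d ⊎ InducedP4 Δ a b c d ⊎ InducedC4 Δ a b c d)

{-# OPTIONS --safe #-}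
module Submission where

-- Let R, μ realize Δ * Γ in ℚ^e, and let ab, cd be edges and ac, bd non-edges of Γ (every
-- induced 2K₂, P₄ or C₄ contains such an alternating four-cycle).  As {a,c} and {b,d} are
-- non-faces of the join, μ = p_a + p_c = p_b + p_d with p_i ∈ R_i.  So μ is the midpoint of
-- x = p_a + p_b ∈ R_{ab} and y = p_c + p_d ∈ R_{cd}, and x ≠ μ because {a,b} is a face.
-- Project ℚ^e linearly onto ℚ^(e-1) along v = μ - x = y - μ.  The images of the R_i (i a vertex
-- of Δ) and of μ realize Δ: if the image of μ lay in the image of R_σ for a face σ of Δ, then
-- μ + t v ∈ R_σ for some t, and μ is a convex combination of that point and x (if t ≥ 0) or
-- y (if t ≤ 0).  Since every R_i contains 0, shrinking both summands puts μ into R_σ + R_{ab}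
-- or R_σ + R_{cd}, although σ ∪ {a,b} and σ ∪ {c,d} are faces of the join.

open import Defs renaming (_+ᵥ_ to infixl 6 _+ᵥ_; _·ᵥ_ to infixr 7 _·ᵥ_; _∈ᴾ_ to infix 4 _∈ᴾ_)
open import Data.Nat using (ℕ; zero; suc; _+_; _≤_; s≤s; _≤?_)
open import Data.Nat.Properties using (+-comm)
open import Data.Fin using (Fin; zero; suc; _↑ˡ_; _↑ʳ_; punchIn; punchOut; _≟_)
open import Data.Fin.Properties using (punchIn-punchOut)
open import Data.Fin.Subset using (Subset; _∈_; ⊥; ⁅_⁆; _∪_; inside; outside)
open import Data.Fin.Subset.Properties using (∪-identityˡ; ∪-identityʳ)
open import Data.Vec using (Vec; []; _∷_; zipWith; replicate; lookup; tabulate; take; drop; _++_; here; there)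
open import Data.Vec.Properties
  using (zipWith-identityˡ; zipWith-identityʳ; zipWith-assoc; zipWith-comm; map-replicate; lookup-zipWith;
         lookup-map; lookup∘tabulate; take++drop≡id; ++-injective; ∷-injectiveˡ; ∷-injectiveʳ)
open import Data.Vec.Relation.Binary.Pointwise.Extensional using (ext; Pointwise-≡⇒≡)
open import Data.Vec.Functional using () renaming (_∷_ to _◂_)
open import Data.Rational using (ℚ; 0ℚ; 1ℚ; 1/_; NonZero; Positive; positive; nonNegative; ≢-nonZero)
  renaming (_+_ to _+ℚ_; _*_ to _*ℚ_; _-_ to _-ℚ_; -_ to -ℚ_; _≤_ to _≤ℚ_; _≟_ to _≟ℚ_)
import Data.Rational.Properties as ℚ
open import Data.Rational.Solver using (module +-*-Solver)
open import Algebra.Properties.Group ℚ.+-0-group using (x∙y⁻¹≈ε⇒x≈y)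
open import Data.Product using (∃; ∃₂; _×_; _,_; proj₁; proj₂)
open import Data.Sum using (_⊎_; inj₁; inj₂; [_,_]′)
open import Function using (_∘_)
open import Function.Bundles using (_⇔_; mk⇔; Equivalence)
open import Relation.Binary.PropositionalEquality
  using (_≡_; _≢_; refl; sym; trans; cong; cong₂; subst; module ≡-Reasoning)
open import Relation.Nullary using (¬_; yes; no; contradiction)
open import Relation.Nullary.Decidable using (decidable-stable)

open +-*-Solver using (solve; _:+_; _:*_; _:-_; :-_; _:=_; con)
open ≡-Reasoning

0≤* : ∀ {a b} → 0ℚ ≤ℚ a → 0ℚ ≤ℚ b → 0ℚ ≤ℚ a *ℚ b
0≤* {a} {b} 0≤a 0≤b =
  ℚ.nonNegative⁻¹ (a *ℚ b) {{ℚ.nonNeg*nonNeg⇒nonNeg a {{nonNegative 0≤a}} b {{nonNegative 0≤b}}}}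

infixl 6 _-ᵥ_
_-ᵥ_ : ∀ {d} → Point d → Point d → Point d
_-ᵥ_ = zipWith _-ℚ_

+ᵥ-identityˡ : ∀ {d} (x : Point d) → 0ᵥ +ᵥ x ≡ x
+ᵥ-identityˡ = zipWith-identityˡ ℚ.+-identityˡ

+ᵥ-identityʳ : ∀ {d} (x : Point d) → x +ᵥ 0ᵥ ≡ x
+ᵥ-identityʳ = zipWith-identityʳ ℚ.+-identityʳ

+ᵥ-assoc : ∀ {d} (x y z : Point d) → x +ᵥ y +ᵥ z ≡ x +ᵥ (y +ᵥ z)
+ᵥ-assoc = zipWith-assoc ℚ.+-assoc

+ᵥ-comm : ∀ {d} (x y : Point d) → x +ᵥ y ≡ y +ᵥ x
+ᵥ-comm = zipWith-comm ℚ.+-comm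

+ᵥ-interchange : ∀ {d} (w x y z : Point d) → (w +ᵥ x) +ᵥ (y +ᵥ z) ≡ (w +ᵥ y) +ᵥ (x +ᵥ z)
+ᵥ-interchange [] [] [] [] = refl
+ᵥ-interchange (a ∷ w) (b ∷ x) (c ∷ y) (d ∷ z) =
  cong₂ _∷_ (solve 4 (λ a b c d → (a :+ b) :+ (c :+ d) := (a :+ c) :+ (b :+ d)) refl a b c d)
            (+ᵥ-interchange w x y z)

·ᵥ-distribˡ : ∀ {d} r (x y : Point d) → r ·ᵥ (x +ᵥ y) ≡ r ·ᵥ x +ᵥ r ·ᵥ y
·ᵥ-distribˡ r [] [] = refl
·ᵥ-distribˡ r (a ∷ x) (b ∷ y) = cong₂ _∷_ (ℚ.*-distribˡ-+ r a b) (·ᵥ-distribˡ r x y)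

·ᵥ-zeroˡ : ∀ {d} (x : Point d) → 0ℚ ·ᵥ x ≡ 0ᵥ
·ᵥ-zeroˡ [] = refl
·ᵥ-zeroˡ (a ∷ x) = cong₂ _∷_ (ℚ.*-zeroˡ a) (·ᵥ-zeroˡ x)

·ᵥ-zeroʳ : ∀ {d} r → r ·ᵥ 0ᵥ {d} ≡ 0ᵥ
·ᵥ-zeroʳ {d} r = trans (map-replicate (r *ℚ_) 0ℚ d) (cong (replicate d) (ℚ.*-zeroʳ r))

·ᵥ-identityˡ : ∀ {d} (x : Point d) → 1ℚ ·ᵥ x ≡ x
·ᵥ-identityˡ [] = refl
·ᵥ-identityˡ (a ∷ x) = cong₂ _∷_ (ℚ.*-identityˡ a) (·ᵥ-identityˡ x)

-ᵥ≡0ᵥ⇒≡ : ∀ {d} {x y : Point d} → x -ᵥ y ≡ 0ᵥ → x ≡ y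
-ᵥ≡0ᵥ⇒≡ {x = []} {[]} _ = refl
-ᵥ≡0ᵥ⇒≡ {x = a ∷ x} {b ∷ y} eq =
  cong₂ _∷_ (x∙y⁻¹≈ε⇒x≈y a b (∷-injectiveˡ eq)) (-ᵥ≡0ᵥ⇒≡ (∷-injectiveʳ eq))

midpoint-difference : ∀ {d} {μ x y : Point d} → x +ᵥ y ≡ μ +ᵥ μ → μ -ᵥ x ≡ y -ᵥ μ
midpoint-difference {μ = []} {[]} {[]} _ = refl
midpoint-difference {μ = m ∷ μ} {a ∷ x} {b ∷ y} eq = cong₂ _∷_ m-a≡b-m (midpoint-difference (∷-injectiveʳ eq))
  where
  m-a≡b-m : m -ℚ a ≡ b -ℚ m
  m-a≡b-m = begin
    m -ℚ a              ≡⟨ solve 2 (λ m a → m :- a := (m :+ m) :- a :- m) refl m a ⟩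
    (m +ℚ m) -ℚ a -ℚ m  ≡⟨ cong (λ u → u -ℚ a -ℚ m) (sym (∷-injectiveˡ eq)) ⟩
    (a +ℚ b) -ℚ a -ℚ m  ≡⟨ solve 3 (λ m a b → (a :+ b) :- a :- m := b :- m) refl m a b ⟩
    b -ℚ m              ∎

ray-reflection : ∀ {d} t (μ y : Point d) → μ +ᵥ t ·ᵥ (y -ᵥ μ) ≡ μ +ᵥ (-ℚ t) ·ᵥ (μ -ᵥ y)
ray-reflection t [] [] = refl
ray-reflection t (m ∷ μ) (b ∷ y) =
  cong₂ _∷_ (solve 3 (λ t m b → m :+ t :* (b :- m) := m :+ (:- t) :* (m :- b)) refl t m b)
            (ray-reflection t μ y)

lookup-+ᵥ : ∀ {d} (x y : Point d) i → lookup (x +ᵥ y) i ≡ lookup x i +ℚ lookup y i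
lookup-+ᵥ x y i = lookup-zipWith _+ℚ_ i x y

lookup-·ᵥ : ∀ {d} c (x : Point d) i → lookup (c ·ᵥ x) i ≡ c *ℚ lookup x i
lookup-·ᵥ c x i = lookup-map i (c *ℚ_) x

nonzero-coordinate : ∀ {d} {v : Point d} → v ≢ 0ᵥ → ∃ λ k → lookup v k ≢ 0ℚ
nonzero-coordinate {v = []} v≢0 = contradiction refl v≢0
nonzero-coordinate {v = a ∷ v} v≢0 with a ≟ℚ 0ℚ
... | no a≢0 = zero , a≢0
... | yes refl with nonzero-coordinate (v≢0 ∘ cong (0ℚ ∷_))
...   | k , vₖ≢0 = suc k , vₖ≢0

ConvexWeights : ℚ → ℚ → Set
ConvexWeights r s = 0ℚ ≤ℚ r × 0ℚ ≤ℚ s × r +ℚ s ≡ 1ℚ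

ConvexWeights-sym : ∀ {r s} → ConvexWeights r s → ConvexWeights s r
ConvexWeights-sym {r} {s} (0≤r , 0≤s , r+s≡1) = 0≤s , 0≤r , trans (ℚ.+-comm s r) r+s≡1

infix 4 _∈[_,_]
_∈[_,_] : ∀ {d} → Point d → Point d → Point d → Set
z ∈[ x , y ] = ∃₂ λ r s → ConvexWeights r s × r ·ᵥ x +ᵥ s ·ᵥ y ≡ z

∈[]-endpoint : ∀ {d} {x y : Point d} → y ∈[ x , y ]
∈[]-endpoint {x = x} {y} =
  0ℚ , 1ℚ , (ℚ.≤-refl , ℚ.nonNegative⁻¹ 1ℚ , ℚ.+-identityˡ 1ℚ) ,
  trans (cong₂ _+ᵥ_ (·ᵥ-zeroˡ x) (·ᵥ-identityˡ y)) (+ᵥ-identityˡ y)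

∈[ray] : ∀ {d} {μ x : Point d} {t} → 0ℚ ≤ℚ t → μ ∈[ μ +ᵥ t ·ᵥ (μ -ᵥ x) , x ]
∈[ray] {μ = μ} {x} {t} 0≤t = r , t *ℚ r , (0≤r , 0≤* 0≤t 0≤r , r+tr≡1) , combination≡μ
  where
  instance
    1+t-positive : Positive (1ℚ +ℚ t)
    1+t-positive = positive (ℚ.+-mono-<-≤ (ℚ.positive⁻¹ 1ℚ) 0≤t)
    1+t-nonZero : NonZero (1ℚ +ℚ t)
    1+t-nonZero = ℚ.pos⇒nonZero (1ℚ +ℚ t)
  r : ℚ
  r = 1/ (1ℚ +ℚ t)
  0≤r : 0ℚ ≤ℚ r
  0≤r = ℚ.<⇒≤ (ℚ.positive⁻¹ r {{ℚ.1/pos⇒pos (1ℚ +ℚ t)}})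
  r[1+t]≡1 : r *ℚ (1ℚ +ℚ t) ≡ 1ℚ
  r[1+t]≡1 = ℚ.*-inverseˡ (1ℚ +ℚ t)
  r+tr≡1 : r +ℚ t *ℚ r ≡ 1ℚ
  r+tr≡1 = trans (solve 2 (λ r t → r :+ t :* r := r :* (con 1ℚ :+ t)) refl r t) r[1+t]≡1
  combination-identity : ∀ {d} (μ x : Point d) →
    r ·ᵥ (μ +ᵥ t ·ᵥ (μ -ᵥ x)) +ᵥ (t *ℚ r) ·ᵥ x ≡ (r *ℚ (1ℚ +ℚ t)) ·ᵥ μ
  combination-identity [] [] = refl
  combination-identity (m ∷ μ) (a ∷ x) =
    cong₂ _∷_ (solve 4 (λ r t m a → r :* (m :+ t :* (m :- a)) :+ (t :* r) :* a := (r :* (con 1ℚ :+ t)) :* m)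
                       refl r t m a)
              (combination-identity μ x)
  combination≡μ : r ·ᵥ (μ +ᵥ t ·ᵥ (μ -ᵥ x)) +ᵥ (t *ℚ r) ·ᵥ x ≡ μ
  combination≡μ = begin
    r ·ᵥ (μ +ᵥ t ·ᵥ (μ -ᵥ x)) +ᵥ (t *ℚ r) ·ᵥ x  ≡⟨ combination-identity μ x ⟩
    (r *ℚ (1ℚ +ℚ t)) ·ᵥ μ                        ≡⟨ cong (_·ᵥ μ) r[1+t]≡1 ⟩
    1ℚ ·ᵥ μ                                      ≡⟨ ·ᵥ-identityˡ μ ⟩
    μ                                            ∎

sumℚ-convex : ∀ {k} r s (κ ν : Fin k → ℚ) →
  sumℚ (λ j → r *ℚ κ j +ℚ s *ℚ ν j) ≡ r *ℚ sumℚ κ +ℚ s *ℚ sumℚ ν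
sumℚ-convex {zero} r s κ ν = solve 2 (λ r s → con 0ℚ := r :* con 0ℚ :+ s :* con 0ℚ) refl r s
sumℚ-convex {suc k} r s κ ν =
  trans (cong (r *ℚ κ zero +ℚ s *ℚ ν zero +ℚ_) (sumℚ-convex r s (κ ∘ suc) (ν ∘ suc)))
        (solve 6 (λ r s a b K N → r :* a :+ s :* b :+ (r :* K :+ s :* N) := r :* (a :+ K) :+ s :* (b :+ N))
               refl r s (κ zero) (ν zero) (sumℚ (κ ∘ suc)) (sumℚ (ν ∘ suc)))

sumᵥ-convex : ∀ {k d} r s (κ ν : Fin k → ℚ) (u : Fin k → Point d) →
  sumᵥ (λ j → (r *ℚ κ j +ℚ s *ℚ ν j) ·ᵥ u j) ≡ r ·ᵥ sumᵥ (λ j → κ j ·ᵥ u j) +ᵥ s ·ᵥ sumᵥ (λ j → ν j ·ᵥ u j)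
sumᵥ-convex {zero} r s κ ν u = sym (trans (cong₂ _+ᵥ_ (·ᵥ-zeroʳ r) (·ᵥ-zeroʳ s)) (+ᵥ-identityˡ 0ᵥ))
sumᵥ-convex {suc k} r s κ ν u =
  trans (cong ((r *ℚ κ zero +ℚ s *ℚ ν zero) ·ᵥ u zero +ᵥ_) (sumᵥ-convex r s (κ ∘ suc) (ν ∘ suc) (u ∘ suc)))
        (distribute (u zero) (sumᵥ (λ j → κ (suc j) ·ᵥ u (suc j))) (sumᵥ (λ j → ν (suc j) ·ᵥ u (suc j))))
  where
  distribute : ∀ {d} (x K N : Point d) →
    (r *ℚ κ zero +ℚ s *ℚ ν zero) ·ᵥ x +ᵥ (r ·ᵥ K +ᵥ s ·ᵥ N) ≡ r ·ᵥ (κ zero ·ᵥ x +ᵥ K) +ᵥ s ·ᵥ (ν zero ·ᵥ x +ᵥ N)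
  distribute [] [] [] = refl
  distribute (c ∷ x) (K₀ ∷ K) (N₀ ∷ N) =
    cong₂ _∷_ (solve 7 (λ r s a b c K N → (r :* a :+ s :* b) :* c :+ (r :* K :+ s :* N)
                                          := r :* (a :* c :+ K) :+ s :* (b :* c :+ N))
                       refl r s (κ zero) (ν zero) c K₀ N₀)
              (distribute x K N)

∈ᴾ-convex : ∀ {d} {P : Polytope d} {p q : Point d} {r s} → ConvexWeights r s →
  p ∈ᴾ P → q ∈ᴾ P → r ·ᵥ p +ᵥ s ·ᵥ q ∈ᴾ P
∈ᴾ-convex {P = P} {r = r} {s} (0≤r , 0≤s , r+s≡1) (κ , 0≤κ , Σκ≡1 , refl) (ν , 0≤ν , Σν≡1 , refl) =
  (λ j → r *ℚ κ j +ℚ s *ℚ ν j) ,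
  (λ j → ℚ.+-mono-≤ (0≤* 0≤r (0≤κ j)) (0≤* 0≤s (0≤ν j))) ,
  weights-sum ,
  sumᵥ-convex r s κ ν (vert P)
  where
  weights-sum : sumℚ (λ j → r *ℚ κ j +ℚ s *ℚ ν j) ≡ 1ℚ
  weights-sum = begin
    sumℚ (λ j → r *ℚ κ j +ℚ s *ℚ ν j)  ≡⟨ sumℚ-convex r s κ ν ⟩
    r *ℚ sumℚ κ +ℚ s *ℚ sumℚ ν          ≡⟨ cong₂ (λ a b → r *ℚ a +ℚ s *ℚ b) Σκ≡1 Σν≡1 ⟩
    r *ℚ 1ℚ +ℚ s *ℚ 1ℚ                  ≡⟨ cong₂ _+ℚ_ (ℚ.*-identityʳ r) (ℚ.*-identityʳ s) ⟩
    r +ℚ s                              ≡⟨ r+s≡1 ⟩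
    1ℚ                                  ∎

∈ᴾ-shrink : ∀ {d} {P : Polytope d} {q : Point d} {r s} → 0ᵥ ∈ᴾ P → ConvexWeights r s → q ∈ᴾ P → r ·ᵥ q ∈ᴾ P
∈ᴾ-shrink {P = P} {q} {r} {s} 0∈P weights q∈P =
  subst (_∈ᴾ P) (trans (cong (r ·ᵥ q +ᵥ_) (·ᵥ-zeroʳ s)) (+ᵥ-identityʳ (r ·ᵥ q))) (∈ᴾ-convex weights q∈P 0∈P)

∈ᴹ-[]⁻ : ∀ {d} {P : Fin 0 → Polytope d} {z} → InMinkowskiSum P [] z → z ≡ 0ᵥ
∈ᴹ-[]⁻ (_ , _ , 0≡z) = sym 0≡z

∈ᴹ-[]⁺ : ∀ {d} {P : Fin 0 → Polytope d} → InMinkowskiSum P [] 0ᵥ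
∈ᴹ-[]⁺ = (λ ()) , (λ ()) , refl

module _ {n d} {P : Fin (suc n) → Polytope d} {S : Subset n} where

  ∈ᴹ-inside⁻ : ∀ {z} → InMinkowskiSum P (inside ∷ S) z →
    ∃₂ λ y w → y ∈ᴾ P zero × InMinkowskiSum (P ∘ suc) S w × y +ᵥ w ≡ z
  ∈ᴹ-inside⁻ (p , p∈P , Σp≡z) =
    p zero , _ , p∈P zero here , (p ∘ suc , (λ i i∈S → p∈P (suc i) (there i∈S)) , refl) , Σp≡z

  ∈ᴹ-inside⁺ : ∀ {y w} → y ∈ᴾ P zero → InMinkowskiSum (P ∘ suc) S w → InMinkowskiSum P (inside ∷ S) (y +ᵥ w)
  ∈ᴹ-inside⁺ {y} y∈P (p , p∈P , refl) = y ◂ p , y◂p∈P , refl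
    where
    y◂p∈P : ∀ i → i ∈ inside ∷ S → (y ◂ p) i ∈ᴾ P i
    y◂p∈P zero    here        = y∈P
    y◂p∈P (suc i) (there i∈S) = p∈P i i∈S

  ∈ᴹ-outside⁻ : ∀ {z} → InMinkowskiSum P (outside ∷ S) z → InMinkowskiSum (P ∘ suc) S z
  ∈ᴹ-outside⁻ (p , p∈P , Σp≡z) =
    p ∘ suc , (λ i i∈S → p∈P (suc i) (there i∈S)) , trans (sym (+ᵥ-identityˡ _)) Σp≡z

  ∈ᴹ-outside⁺ : ∀ {z} → InMinkowskiSum (P ∘ suc) S z → InMinkowskiSum P (outside ∷ S) z
  ∈ᴹ-outside⁺ (p , p∈P , Σp≡z) = 0ᵥ ◂ p , 0◂p∈P , trans (+ᵥ-identityˡ _) Σp≡z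
    where
    0◂p∈P : ∀ i → i ∈ outside ∷ S → (0ᵥ ◂ p) i ∈ᴾ P i
    0◂p∈P (suc i) (there i∈S) = p∈P i i∈S

∈ᴹ-⊥⁺ : ∀ {n d} {P : Fin n → Polytope d} → InMinkowskiSum P ⊥ 0ᵥ
∈ᴹ-⊥⁺ {zero}  = ∈ᴹ-[]⁺
∈ᴹ-⊥⁺ {suc n} = ∈ᴹ-outside⁺ ∈ᴹ-⊥⁺

∈ᴹ-⊥⁻ : ∀ {n d} {P : Fin n → Polytope d} {z} → InMinkowskiSum P ⊥ z → z ≡ 0ᵥ
∈ᴹ-⊥⁻ {zero}  = ∈ᴹ-[]⁻
∈ᴹ-⊥⁻ {suc n} = ∈ᴹ-⊥⁻ ∘ ∈ᴹ-outside⁻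

∈ᴹ-⁅⁆⁺ : ∀ {n d} {P : Fin n → Polytope d} {y} j → y ∈ᴾ P j → InMinkowskiSum P ⁅ j ⁆ y
∈ᴹ-⁅⁆⁺ zero    y∈P = subst (InMinkowskiSum _ _) (+ᵥ-identityʳ _) (∈ᴹ-inside⁺ y∈P ∈ᴹ-⊥⁺)
∈ᴹ-⁅⁆⁺ (suc j) y∈P = ∈ᴹ-outside⁺ (∈ᴹ-⁅⁆⁺ j y∈P)

∈ᴹ-⁅⁆⁻ : ∀ {n d} {P : Fin n → Polytope d} {z} j → InMinkowskiSum P ⁅ j ⁆ z → z ∈ᴾ P j
∈ᴹ-⁅⁆⁻ zero h with ∈ᴹ-inside⁻ h
... | y , w , y∈P , w∈⊥ , refl with ∈ᴹ-⊥⁻ w∈⊥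
...   | refl = subst (_∈ᴾ _) (sym (+ᵥ-identityʳ y)) y∈P
∈ᴹ-⁅⁆⁻ (suc j) h = ∈ᴹ-⁅⁆⁻ j (∈ᴹ-outside⁻ h)

∈ᴹ-pair⁺ : ∀ {n d} {P : Fin n → Polytope d} {a b p q} → a ≢ b →
  p ∈ᴾ P a → q ∈ᴾ P b → InMinkowskiSum P (⁅ a ⁆ ∪ ⁅ b ⁆) (p +ᵥ q)
∈ᴹ-pair⁺ {a = zero}  {zero}  a≢b _ _ = contradiction refl a≢b
∈ᴹ-pair⁺ {a = zero}  {suc b} _ p∈P q∈P =
  ∈ᴹ-inside⁺ p∈P (subst (λ S → InMinkowskiSum _ S _) (sym (∪-identityˡ ⁅ b ⁆)) (∈ᴹ-⁅⁆⁺ b q∈P))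
∈ᴹ-pair⁺ {a = suc a} {zero}  _ p∈P q∈P =
  subst (InMinkowskiSum _ _) (+ᵥ-comm _ _)
    (∈ᴹ-inside⁺ q∈P (subst (λ S → InMinkowskiSum _ S _) (sym (∪-identityʳ ⁅ a ⁆)) (∈ᴹ-⁅⁆⁺ a p∈P)))
∈ᴹ-pair⁺ {a = suc a} {suc b} a≢b p∈P q∈P = ∈ᴹ-outside⁺ (∈ᴹ-pair⁺ (a≢b ∘ cong suc) p∈P q∈P)

∈ᴹ-pair⁻ : ∀ {n d} {P : Fin n → Polytope d} {a b z} → a ≢ b →
  InMinkowskiSum P (⁅ a ⁆ ∪ ⁅ b ⁆) z → ∃₂ λ p q → p ∈ᴾ P a × q ∈ᴾ P b × p +ᵥ q ≡ z
∈ᴹ-pair⁻ {a = zero}  {zero}  a≢b _ = contradiction refl a≢b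
∈ᴹ-pair⁻ {a = zero}  {suc b} _ h with ∈ᴹ-inside⁻ h
... | p , q , p∈P , q∈P , p+q≡z =
  p , q , p∈P , ∈ᴹ-⁅⁆⁻ b (subst (λ S → InMinkowskiSum _ S _) (∪-identityˡ ⁅ b ⁆) q∈P) , p+q≡z
∈ᴹ-pair⁻ {a = suc a} {zero}  _ h with ∈ᴹ-inside⁻ h
... | q , p , q∈P , p∈P , q+p≡z =
  p , q , ∈ᴹ-⁅⁆⁻ a (subst (λ S → InMinkowskiSum _ S _) (∪-identityʳ ⁅ a ⁆) p∈P) , q∈P , trans (+ᵥ-comm p q) q+p≡z
∈ᴹ-pair⁻ {a = suc a} {suc b} a≢b h = ∈ᴹ-pair⁻ (a≢b ∘ cong suc) (∈ᴹ-outside⁻ h)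

∈ᴹ-++⁺ : ∀ {n m d} {P : Fin (n + m) → Polytope d} (σ : Subset n) {τ : Subset m} {w x} →
  InMinkowskiSum (λ i → P (i ↑ˡ m)) σ w → InMinkowskiSum (λ j → P (n ↑ʳ j)) τ x →
  InMinkowskiSum P (σ ++ τ) (w +ᵥ x)
∈ᴹ-++⁺ [] {x = x} w∈ x∈ =
  subst (InMinkowskiSum _ _) (sym (trans (cong (_+ᵥ x) (∈ᴹ-[]⁻ w∈)) (+ᵥ-identityˡ x))) x∈
∈ᴹ-++⁺ (outside ∷ σ) w∈ x∈ = ∈ᴹ-outside⁺ (∈ᴹ-++⁺ σ (∈ᴹ-outside⁻ w∈) x∈)
∈ᴹ-++⁺ (inside ∷ σ) w∈ x∈ with ∈ᴹ-inside⁻ w∈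
... | y , w , y∈ , w∈′ , refl =
  subst (InMinkowskiSum _ _) (sym (+ᵥ-assoc y w _)) (∈ᴹ-inside⁺ y∈ (∈ᴹ-++⁺ σ w∈′ x∈))

∈ᴹ-++⊥⁻ : ∀ {n m d} {P : Fin (n + m) → Polytope d} (σ : Subset n) {z} →
  InMinkowskiSum P (σ ++ ⊥) z → InMinkowskiSum (λ i → P (i ↑ˡ m)) σ z
∈ᴹ-++⊥⁻ [] h = subst (InMinkowskiSum _ []) (sym (∈ᴹ-⊥⁻ h)) ∈ᴹ-[]⁺
∈ᴹ-++⊥⁻ (outside ∷ σ) h = ∈ᴹ-outside⁺ (∈ᴹ-++⊥⁻ σ (∈ᴹ-outside⁻ h))
∈ᴹ-++⊥⁻ (inside ∷ σ) h with ∈ᴹ-inside⁻ h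
... | y , w , y∈ , w∈ , refl = ∈ᴹ-inside⁺ y∈ (∈ᴹ-++⊥⁻ σ w∈)

∈ᴹ-⊥++⁻ : ∀ {n m d} {P : Fin (n + m) → Polytope d} {τ : Subset m} {z} →
  InMinkowskiSum P (⊥ {n} ++ τ) z → InMinkowskiSum (λ j → P (n ↑ʳ j)) τ z
∈ᴹ-⊥++⁻ {zero}  h = h
∈ᴹ-⊥++⁻ {suc n} h = ∈ᴹ-⊥++⁻ {n} (∈ᴹ-outside⁻ h)

∈ᴹ-shrink : ∀ {n d} {P : Fin n → Polytope d} {S z r s} → (∀ i → 0ᵥ ∈ᴾ P i) → ConvexWeights r s →
  InMinkowskiSum P S z → InMinkowskiSum P S (r ·ᵥ z)
∈ᴹ-shrink {S = []} {r = r} _ _ h =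
  subst (InMinkowskiSum _ []) (sym (trans (cong (r ·ᵥ_) (∈ᴹ-[]⁻ h)) (·ᵥ-zeroʳ r))) ∈ᴹ-[]⁺
∈ᴹ-shrink {S = outside ∷ S} 0∈P weights h = ∈ᴹ-outside⁺ (∈ᴹ-shrink (0∈P ∘ suc) weights (∈ᴹ-outside⁻ h))
∈ᴹ-shrink {S = inside ∷ S} {r = r} 0∈P weights h with ∈ᴹ-inside⁻ h
... | y , w , y∈ , w∈ , refl =
  subst (InMinkowskiSum _ _) (sym (·ᵥ-distribˡ r y w))
    (∈ᴹ-inside⁺ (∈ᴾ-shrink (0∈P zero) weights y∈) (∈ᴹ-shrink (0∈P ∘ suc) weights w∈))

record LinearMap (d d′ : ℕ) : Set where
  field
    apply   : Point d → Point d′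
    apply-+ : ∀ x y → apply (x +ᵥ y) ≡ apply x +ᵥ apply y
    apply-· : ∀ c x → apply (c ·ᵥ x) ≡ c ·ᵥ apply x

module _ {d d′} (f : LinearMap d d′) where
  open LinearMap f

  apply-0ᵥ : apply 0ᵥ ≡ 0ᵥ
  apply-0ᵥ = begin
    apply 0ᵥ           ≡⟨ cong apply (sym (·ᵥ-zeroˡ 0ᵥ)) ⟩
    apply (0ℚ ·ᵥ 0ᵥ)   ≡⟨ apply-· 0ℚ 0ᵥ ⟩
    0ℚ ·ᵥ apply 0ᵥ     ≡⟨ ·ᵥ-zeroˡ (apply 0ᵥ) ⟩
    0ᵥ                 ∎

  apply-combination : ∀ {k} (κ : Fin k → ℚ) (u : Fin k → Point d) →
    apply (sumᵥ (λ j → κ j ·ᵥ u j)) ≡ sumᵥ (λ j → κ j ·ᵥ apply (u j))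
  apply-combination {zero} κ u = apply-0ᵥ
  apply-combination {suc k} κ u = begin
    apply (κ zero ·ᵥ u zero +ᵥ rest)          ≡⟨ apply-+ _ rest ⟩
    apply (κ zero ·ᵥ u zero) +ᵥ apply rest    ≡⟨ cong₂ _+ᵥ_ (apply-· (κ zero) (u zero)) (apply-combination (κ ∘ suc) (u ∘ suc)) ⟩
    κ zero ·ᵥ apply (u zero) +ᵥ sumᵥ (λ j → κ (suc j) ·ᵥ apply (u (suc j)))  ∎
    where
    rest : Point d
    rest = sumᵥ (λ j → κ (suc j) ·ᵥ u (suc j))

  imageᴾ : Polytope d → Polytope d′
  imageᴾ P = record { #vert = #vert P ; vert = apply ∘ vert P }

  ∈ᴾ-image : ∀ {P q} → q ∈ᴾ P → apply q ∈ᴾ imageᴾ P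
  ∈ᴾ-image {P} (κ , 0≤κ , Σκ≡1 , refl) = κ , 0≤κ , Σκ≡1 , sym (apply-combination κ (vert P))

  ∈ᴾ-image⁻ : ∀ {P q} → q ∈ᴾ imageᴾ P → ∃ λ p → p ∈ᴾ P × apply p ≡ q
  ∈ᴾ-image⁻ {P} (κ , 0≤κ , Σκ≡1 , refl) = _ , (κ , 0≤κ , Σκ≡1 , refl) , apply-combination κ (vert P)

  ∈ᴹ-image : ∀ {n} {P : Fin n → Polytope d} (S : Subset n) {z} →
    InMinkowskiSum P S z → InMinkowskiSum (imageᴾ ∘ P) S (apply z)
  ∈ᴹ-image [] h = subst (InMinkowskiSum _ []) (sym (trans (cong apply (∈ᴹ-[]⁻ h)) apply-0ᵥ)) ∈ᴹ-[]⁺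
  ∈ᴹ-image (outside ∷ S) h = ∈ᴹ-outside⁺ (∈ᴹ-image S (∈ᴹ-outside⁻ h))
  ∈ᴹ-image (inside ∷ S) h with ∈ᴹ-inside⁻ h
  ... | y , w , y∈ , w∈ , refl =
    subst (InMinkowskiSum _ _) (sym (apply-+ y w)) (∈ᴹ-inside⁺ (∈ᴾ-image y∈) (∈ᴹ-image S w∈))

  ∈ᴹ-image⁻ : ∀ {n} {P : Fin n → Polytope d} (S : Subset n) {z} →
    InMinkowskiSum (imageᴾ ∘ P) S z → ∃ λ y → InMinkowskiSum P S y × apply y ≡ z
  ∈ᴹ-image⁻ [] h = 0ᵥ , ∈ᴹ-[]⁺ , trans apply-0ᵥ (sym (∈ᴹ-[]⁻ h))
  ∈ᴹ-image⁻ (outside ∷ S) h with ∈ᴹ-image⁻ S (∈ᴹ-outside⁻ h)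
  ... | y , y∈ , fy≡z = y , ∈ᴹ-outside⁺ y∈ , fy≡z
  ∈ᴹ-image⁻ (inside ∷ S) h with ∈ᴹ-inside⁻ h
  ... | y′ , w′ , y′∈ , w′∈ , refl with ∈ᴾ-image⁻ y′∈ | ∈ᴹ-image⁻ S w′∈
  ...   | y , y∈ , refl | w , w∈ , refl = y +ᵥ w , ∈ᴹ-inside⁺ y∈ w∈ , apply-+ y w

module Projection {e} (v : Point (suc e)) (k : Fin (suc e)) (vₖ≢0 : lookup v k ≢ 0ℚ) where

  private
    instance
      vₖ-nonZero : NonZero (lookup v k)
      vₖ-nonZero = ≢-nonZero vₖ≢0

    w : ℚ
    w = 1/ lookup v k

    coeff : Point (suc e) → ℚ
    coeff x = lookup x k *ℚ w

  -- x - coeff x ·ᵥ v has k-th coordinate 0; shadow x is that vector with the coordinate deleted.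
  shadow : Point (suc e) → Point e
  shadow x = tabulate λ j → lookup x (punchIn k j) -ℚ coeff x *ℚ lookup v (punchIn k j)

  private
    lookup-shadow : ∀ x j → lookup (shadow x) j ≡ lookup x (punchIn k j) -ℚ coeff x *ℚ lookup v (punchIn k j)
    lookup-shadow x j = lookup∘tabulate _ j

    lookup-shadow-punchOut : ∀ {i} (k≢i : k ≢ i) x →
      lookup (shadow x) (punchOut k≢i) ≡ lookup x i -ℚ coeff x *ℚ lookup v i
    lookup-shadow-punchOut k≢i x =
      trans (lookup-shadow x (punchOut k≢i)) (cong (λ i → lookup x i -ℚ coeff x *ℚ lookup v i) (punchIn-punchOut k≢i))

  shadow-+ : ∀ x y → shadow (x +ᵥ y) ≡ shadow x +ᵥ shadow y
  shadow-+ x y = Pointwise-≡⇒≡ (ext coordinate)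
    where
    coordinate : ∀ j → lookup (shadow (x +ᵥ y)) j ≡ lookup (shadow x +ᵥ shadow y) j
    coordinate j = begin
      lookup (shadow (x +ᵥ y)) j
        ≡⟨ lookup-shadow (x +ᵥ y) j ⟩
      lookup (x +ᵥ y) i -ℚ (lookup (x +ᵥ y) k *ℚ w) *ℚ lookup v i
        ≡⟨ cong₂ (λ a b → a -ℚ (b *ℚ w) *ℚ lookup v i) (lookup-+ᵥ x y i) (lookup-+ᵥ x y k) ⟩
      (lookup x i +ℚ lookup y i) -ℚ ((lookup x k +ℚ lookup y k) *ℚ w) *ℚ lookup v i
        ≡⟨ solve 6 (λ a b c d w u → (a :+ b) :- ((c :+ d) :* w) :* u := (a :- (c :* w) :* u) :+ (b :- (d :* w) :* u))
                   refl (lookup x i) (lookup y i) (lookup x k) (lookup y k) w (lookup v i) ⟩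
      (lookup x i -ℚ coeff x *ℚ lookup v i) +ℚ (lookup y i -ℚ coeff y *ℚ lookup v i)
        ≡⟨ sym (cong₂ _+ℚ_ (lookup-shadow x j) (lookup-shadow y j)) ⟩
      lookup (shadow x) j +ℚ lookup (shadow y) j
        ≡⟨ sym (lookup-+ᵥ (shadow x) (shadow y) j) ⟩
      lookup (shadow x +ᵥ shadow y) j ∎
      where
      i : Fin (suc e)
      i = punchIn k j

  shadow-· : ∀ c x → shadow (c ·ᵥ x) ≡ c ·ᵥ shadow x
  shadow-· c x = Pointwise-≡⇒≡ (ext coordinate)
    where
    coordinate : ∀ j → lookup (shadow (c ·ᵥ x)) j ≡ lookup (c ·ᵥ shadow x) j
    coordinate j = begin
      lookup (shadow (c ·ᵥ x)) j
        ≡⟨ lookup-shadow (c ·ᵥ x) j ⟩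
      lookup (c ·ᵥ x) i -ℚ (lookup (c ·ᵥ x) k *ℚ w) *ℚ lookup v i
        ≡⟨ cong₂ (λ a b → a -ℚ (b *ℚ w) *ℚ lookup v i) (lookup-·ᵥ c x i) (lookup-·ᵥ c x k) ⟩
      c *ℚ lookup x i -ℚ ((c *ℚ lookup x k) *ℚ w) *ℚ lookup v i
        ≡⟨ solve 5 (λ c a b w u → c :* a :- ((c :* b) :* w) :* u := c :* (a :- (b :* w) :* u))
                   refl c (lookup x i) (lookup x k) w (lookup v i) ⟩
      c *ℚ (lookup x i -ℚ coeff x *ℚ lookup v i)
        ≡⟨ sym (cong (c *ℚ_) (lookup-shadow x j)) ⟩
      c *ℚ lookup (shadow x) j
        ≡⟨ sym (lookup-·ᵥ c (shadow x) j) ⟩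
      lookup (c ·ᵥ shadow x) j ∎
      where
      i : Fin (suc e)
      i = punchIn k j

  shadowₗ : LinearMap (suc e) e
  shadowₗ = record { apply = shadow ; apply-+ = shadow-+ ; apply-· = shadow-· }

  shadow-kernel : ∀ {x y} → shadow x ≡ shadow y → ∃ λ t → x ≡ y +ᵥ t ·ᵥ v
  shadow-kernel {x} {y} shadow-x≡shadow-y = t , Pointwise-≡⇒≡ (ext λ i → trans (coordinate i) (sym (lookup-y+tv i)))
    where
    t : ℚ
    t = coeff x -ℚ coeff y

    lookup-y+tv : ∀ i → lookup (y +ᵥ t ·ᵥ v) i ≡ lookup y i +ℚ t *ℚ lookup v i
    lookup-y+tv i = trans (lookup-+ᵥ y (t ·ᵥ v) i) (cong (lookup y i +ℚ_) (lookup-·ᵥ t v i))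

    coordinate : ∀ i → lookup x i ≡ lookup y i +ℚ t *ℚ lookup v i
    coordinate i with k ≟ i
    ... | yes refl = sym (begin
      lookup y k +ℚ (lookup x k *ℚ w -ℚ lookup y k *ℚ w) *ℚ lookup v k
        ≡⟨ solve 4 (λ a b w u → b :+ (a :* w :- b :* w) :* u := b :+ (a :- b) :* (w :* u))
                   refl (lookup x k) (lookup y k) w (lookup v k) ⟩
      lookup y k +ℚ (lookup x k -ℚ lookup y k) *ℚ (w *ℚ lookup v k)
        ≡⟨ cong (λ u → lookup y k +ℚ (lookup x k -ℚ lookup y k) *ℚ u) (ℚ.*-inverseˡ (lookup v k)) ⟩
      lookup y k +ℚ (lookup x k -ℚ lookup y k) *ℚ 1ℚ
        ≡⟨ solve 2 (λ a b → b :+ (a :- b) :* con 1ℚ := a) refl (lookup x k) (lookup y k) ⟩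
      lookup x k ∎)
    ... | no k≢i = begin
      lookup x i
        ≡⟨ solve 3 (λ a c u → a := (a :- c :* u) :+ c :* u) refl (lookup x i) (coeff x) (lookup v i) ⟩
      (lookup x i -ℚ coeff x *ℚ lookup v i) +ℚ coeff x *ℚ lookup v i
        ≡⟨ cong (_+ℚ coeff x *ℚ lookup v i) shadows-agree ⟩
      (lookup y i -ℚ coeff y *ℚ lookup v i) +ℚ coeff x *ℚ lookup v i
        ≡⟨ solve 4 (λ b c d u → (b :- d :* u) :+ c :* u := b :+ (c :- d) :* u)
                   refl (lookup y i) (coeff x) (coeff y) (lookup v i) ⟩
      lookup y i +ℚ t *ℚ lookup v i ∎
      where
      shadows-agree : lookup x i -ℚ coeff x *ℚ lookup v i ≡ lookup y i -ℚ coeff y *ℚ lookup v i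
      shadows-agree = begin
        lookup x i -ℚ coeff x *ℚ lookup v i  ≡⟨ sym (lookup-shadow-punchOut k≢i x) ⟩
        lookup (shadow x) (punchOut k≢i)     ≡⟨ cong (λ z → lookup z (punchOut k≢i)) shadow-x≡shadow-y ⟩
        lookup (shadow y) (punchOut k≢i)     ≡⟨ lookup-shadow-punchOut k≢i y ⟩
        lookup y i -ℚ coeff y *ℚ lookup v i  ∎

take-drop-++ : ∀ {A : Set} {n m} (σ : Vec A n) (τ : Vec A m) → take n (σ ++ τ) ≡ σ × drop n (σ ++ τ) ≡ τ
take-drop-++ {n = n} σ τ = ++-injective (take n (σ ++ τ)) σ (take++drop≡id n (σ ++ τ))

record AlternatingFourCycle {m} (Γ : Family m) : Set where
  constructor alternating
  field
    a b c d     : Fin m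
    a≢b         : a ≢ b
    c≢d         : c ≢ d
    a≢c         : a ≢ c
    b≢d         : b ≢ d
    ab-edge     : Edge Γ a b
    cd-edge     : Edge Γ c d
    ac-non-edge : ¬ Edge Γ a c
    bd-non-edge : ¬ Edge Γ b d

alternating-four-cycle : ∀ {m} {Γ : Family m} → HasInduced2K2orP4orC4 Γ → AlternatingFourCycle Γ
alternating-four-cycle {Γ = Γ} (a , b , c , d , (a≢b , a≢c , _ , _ , b≢d , c≢d) , induced)
  with shared-edges induced
  where
  shared-edges : Induced2K2 Γ a b c d ⊎ InducedP4 Γ a b c d ⊎ InducedC4 Γ a b c d →
    Edge Γ a b × Edge Γ c d × ¬ Edge Γ a c × ¬ Edge Γ b d
  shared-edges (inj₁ (ab , cd , ¬ac , _ , _ , ¬bd))        = ab , cd , ¬ac , ¬bd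
  shared-edges (inj₂ (inj₁ (ab , _ , cd , ¬ac , _ , ¬bd))) = ab , cd , ¬ac , ¬bd
  shared-edges (inj₂ (inj₂ (ab , _ , cd , _ , ¬ac , ¬bd))) = ab , cd , ¬ac , ¬bd
... | ab , cd , ¬ac , ¬bd = alternating a b c d a≢b c≢d a≢c b≢d ab cd ¬ac ¬bd

module JoinRealization {n m e} (Δ : SimplicialComplex n) (Γ : SimplicialComplex m)
                       (ρ : RealizableIn (Face Δ *ᶠ Face Γ) e) where

  R : Fin (n + m) → Polytope e
  R = proj₁ ρ

  μ : Point e
  μ = proj₁ (proj₂ ρ)

  0∈R : ∀ i → 0ᵥ ∈ᴾ R i
  0∈R = proj₁ (proj₂ (proj₂ ρ))

  realizes : ∀ S → (Face Δ *ᶠ Face Γ) S ⇔ (¬ InMinkowskiSum R S μ)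
  realizes = proj₂ (proj₂ (proj₂ ρ))

  Rˡ : Fin n → Polytope e
  Rˡ i = R (i ↑ˡ m)

  Rʳ : Fin m → Polytope e
  Rʳ j = R (n ↑ʳ j)

  private
    faces⇒join : ∀ {σ τ} → Face Δ σ → Face Γ τ → (Face Δ *ᶠ Face Γ) (σ ++ τ)
    faces⇒join {σ} {τ} σ∈Δ τ∈Γ =
      subst (Face Δ) (sym (proj₁ (take-drop-++ σ τ))) σ∈Δ , subst (Face Γ) (sym (proj₂ (take-drop-++ σ τ))) τ∈Γ

    join⇒faces : ∀ {σ τ} → (Face Δ *ᶠ Face Γ) (σ ++ τ) → Face Δ σ × Face Γ τ
    join⇒faces {σ} {τ} (σ∈Δ , τ∈Γ) =
      subst (Face Δ) (proj₁ (take-drop-++ σ τ)) σ∈Δ , subst (Face Γ) (proj₂ (take-drop-++ σ τ)) τ∈Γ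

  join-face-avoids : ∀ {σ τ z x} → Face Δ σ → Face Γ τ →
    InMinkowskiSum Rˡ σ z → InMinkowskiSum Rʳ τ x → ¬ μ ∈[ z , x ]
  join-face-avoids {σ} {τ} σ∈Δ τ∈Γ z∈Rˡ x∈Rʳ (r , s , weights , rz+sx≡μ) =
    Equivalence.to (realizes (σ ++ τ)) (faces⇒join σ∈Δ τ∈Γ)
      (subst (InMinkowskiSum R (σ ++ τ)) rz+sx≡μ
        (∈ᴹ-++⁺ σ (∈ᴹ-shrink (0∈R ∘ (_↑ˡ m)) weights z∈Rˡ)
                  (∈ᴹ-shrink (0∈R ∘ (n ↑ʳ_)) (ConvexWeights-sym weights) x∈Rʳ)))

  ray-avoids : ∀ {σ τ x t} → Face Δ σ → Face Γ τ → InMinkowskiSum Rʳ τ x → 0ℚ ≤ℚ t →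
    ¬ InMinkowskiSum Rˡ σ (μ +ᵥ t ·ᵥ (μ -ᵥ x))
  ray-avoids σ∈Δ τ∈Γ x∈Rʳ 0≤t z∈Rˡ = join-face-avoids σ∈Δ τ∈Γ z∈Rˡ x∈Rʳ (∈[ray] 0≤t)

  face-if-avoids : ∀ {σ} → ¬ InMinkowskiSum Rˡ σ μ → Face Δ σ
  face-if-avoids {σ} μ∉Rˡ = proj₁ (join⇒faces (Equivalence.from (realizes (σ ++ ⊥)) (μ∉Rˡ ∘ ∈ᴹ-++⊥⁻ σ)))

  nonface-meets : ∀ {τ} → ¬ Face Γ τ → ¬ ¬ InMinkowskiSum Rʳ τ μ
  nonface-meets {τ} τ∉Γ μ∉Rʳ = τ∉Γ (proj₂ (join⇒faces (Equivalence.from (realizes (⊥ ++ τ)) (μ∉Rʳ ∘ ∈ᴹ-⊥++⁻))))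

  record MidpointOfFaces : Set where
    field
      τ₁ τ₂    : Subset m
      τ₁∈Γ     : Face Γ τ₁
      τ₂∈Γ     : Face Γ τ₂
      x y      : Point e
      x∈Rʳ     : InMinkowskiSum Rʳ τ₁ x
      y∈Rʳ     : InMinkowskiSum Rʳ τ₂ y
      midpoint : x +ᵥ y ≡ μ +ᵥ μ

  midpoint-of-faces : AlternatingFourCycle (Face Γ) → ¬ ¬ MidpointOfFaces
  midpoint-of-faces cycle no-midpoint =
    nonface-meets ac-non-edge λ μ∈Rac →
    nonface-meets bd-non-edge λ μ∈Rbd →
    no-midpoint (from-pairs (∈ᴹ-pair⁻ a≢c μ∈Rac) (∈ᴹ-pair⁻ b≢d μ∈Rbd))
    where
    open AlternatingFourCycle cycle
    from-pairs : (∃₂ λ p q → p ∈ᴾ Rʳ a × q ∈ᴾ Rʳ c × p +ᵥ q ≡ μ) →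
                 (∃₂ λ p q → p ∈ᴾ Rʳ b × q ∈ᴾ Rʳ d × p +ᵥ q ≡ μ) → MidpointOfFaces
    from-pairs (pa , pc , pa∈ , pc∈ , pa+pc≡μ) (pb , pd , pb∈ , pd∈ , pb+pd≡μ) = record
      { τ₁ = ⁅ a ⁆ ∪ ⁅ b ⁆ ; τ₂ = ⁅ c ⁆ ∪ ⁅ d ⁆ ; τ₁∈Γ = ab-edge ; τ₂∈Γ = cd-edge
      ; x = pa +ᵥ pb ; y = pc +ᵥ pd ; x∈Rʳ = ∈ᴹ-pair⁺ a≢b pa∈ pb∈ ; y∈Rʳ = ∈ᴹ-pair⁺ c≢d pc∈ pd∈
      ; midpoint = trans (+ᵥ-interchange pa pb pc pd) (cong₂ _+ᵥ_ pa+pc≡μ pb+pd≡μ)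
      }

  direction-nonzero : (mp : MidpointOfFaces) → μ -ᵥ MidpointOfFaces.x mp ≢ 0ᵥ
  direction-nonzero mp μ-x≡0 =
    join-face-avoids (empty-face Δ) τ₁∈Γ ∈ᴹ-⊥⁺ x∈Rʳ (subst (_∈[ 0ᵥ , x ]) (sym (-ᵥ≡0ᵥ⇒≡ μ-x≡0)) ∈[]-endpoint)
    where
    open MidpointOfFaces mp

module Projected {n m e} (Δ : SimplicialComplex n) (Γ : SimplicialComplex m)
                 (ρ : RealizableIn (Face Δ *ᶠ Face Γ) (suc e)) (mp : JoinRealization.MidpointOfFaces Δ Γ ρ) where

  open JoinRealization Δ Γ ρ
  open MidpointOfFaces mp

  private
    nonzero-direction-coordinate : ∃ λ k → lookup (μ -ᵥ x) k ≢ 0ℚ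
    nonzero-direction-coordinate = nonzero-coordinate (direction-nonzero mp)

  open Projection (μ -ᵥ x) (proj₁ nonzero-direction-coordinate) (proj₂ nonzero-direction-coordinate)

  P : Fin n → Polytope e
  P i = imageᴾ shadowₗ (Rˡ i)

  face⇒avoids : ∀ {σ} → Face Δ σ → ¬ InMinkowskiSum P σ (shadow μ)
  face⇒avoids {σ} σ∈Δ shadow-μ∈P = lift-avoids (∈ᴹ-image⁻ shadowₗ {P = Rˡ} σ shadow-μ∈P)
    where
    line-avoids : ∀ {z} → (∃ λ t → z ≡ μ +ᵥ t ·ᵥ (μ -ᵥ x)) → ¬ InMinkowskiSum Rˡ σ z
    line-avoids (t , refl) = [ away-from-x , away-from-y ]′ (ℚ.≤-total 0ℚ t)
      where
      away-from-x : 0ℚ ≤ℚ t → ¬ InMinkowskiSum Rˡ σ (μ +ᵥ t ·ᵥ (μ -ᵥ x))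
      away-from-x = ray-avoids σ∈Δ τ₁∈Γ x∈Rʳ
      away-from-y : t ≤ℚ 0ℚ → ¬ InMinkowskiSum Rˡ σ (μ +ᵥ t ·ᵥ (μ -ᵥ x))
      away-from-y t≤0 = ray-avoids σ∈Δ τ₂∈Γ y∈Rʳ (ℚ.neg-antimono-≤ t≤0) ∘ subst (InMinkowskiSum Rˡ σ) same-point
        where
        same-point : μ +ᵥ t ·ᵥ (μ -ᵥ x) ≡ μ +ᵥ (-ℚ t) ·ᵥ (μ -ᵥ y)
        same-point = trans (cong (λ u → μ +ᵥ t ·ᵥ u) (midpoint-difference midpoint)) (ray-reflection t μ y)
    lift-avoids : ¬ ∃ λ z → InMinkowskiSum Rˡ σ z × shadow z ≡ shadow μ
    lift-avoids (z , z∈Rˡ , shadow-z≡shadow-μ) = line-avoids (shadow-kernel shadow-z≡shadow-μ) z∈Rˡ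

  realization : RealizableIn (Face Δ) e
  realization = P , shadow μ , 0∈P , λ σ → mk⇔ face⇒avoids (λ avoids → face-if-avoids (avoids ∘ ∈ᴹ-image shadowₗ σ))
    where
    0∈P : ∀ i → 0ᵥ ∈ᴾ P i
    0∈P i = subst (_∈ᴾ P i) (apply-0ᵥ shadowₗ) (∈ᴾ-image shadowₗ (0∈R (i ↑ˡ m)))

drop-dimension : ∀ {n m e} (Δ : SimplicialComplex n) (Γ : SimplicialComplex m)
  (ρ : RealizableIn (Face Δ *ᶠ Face Γ) e) → JoinRealization.MidpointOfFaces Δ Γ ρ →
  ∃ λ e′ → suc e′ ≡ e × RealizableIn (Face Δ) e′
drop-dimension {e = zero} Δ Γ ρ mp
  with () ← proj₁ (nonzero-coordinate (JoinRealization.direction-nonzero Δ Γ ρ mp))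
drop-dimension {e = suc e} Δ Γ ρ mp = e , refl , Projected.realization Δ Γ ρ mp

theorem3 : ∀ {n m} (Δ : SimplicialComplex n) (Γ : SimplicialComplex m) →
    HasInduced2K2orP4orC4 (Face Γ) →
    ∀ (c e : ℕ) → IsCtd (Face Δ) c → IsCtd (Face Δ *ᶠ Face Γ) e →
    c + 1 ≤ e
theorem3 Δ Γ induced c e (_ , c-least) (ρ , _) =
  decidable-stable (c + 1 ≤? e) λ c+1≰e →
    midpoint-of-faces (alternating-four-cycle induced) λ mp →
      c+1≰e (bound (drop-dimension Δ Γ ρ mp))
  where
  open JoinRealization Δ Γ ρ using (midpoint-of-faces)
  bound : (∃ λ e′ → suc e′ ≡ e × RealizableIn (Face Δ) e′) → c + 1 ≤ e
  bound (e′ , refl , ρΔ) = subst (_≤ suc e′) (+-comm 1 c) (s≤s (c-least e′ ρΔ))
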